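{- Let $G$ be a graph, and let $D$ denote the set of vertices of $G$ of degree $1$. Let $v\in V(G)$ be a vertex such that $N(v)\cap D=\{u_1,u_2\}$. Then $G$ has an IP-partition of minimum cardinality containing the path $(u_1,v,u_2)$.
   Context: All graphs are finite, simple and undirected; $N(v)$ denotes the set of neighbours of $v$. A path is isometric if it is a shortest path in $G$ between its endpoints. An IP-partition of $G$ is a partition of $V(G)$ into vertex sets of isometric paths of $G$; its cardinality is the number of paths. -}

module Defs where

open import Data.Nat using (ℕ; zero; suc; _≤_; _∸_)
open import Data.Bool using (Bool; T)
open import Data.Fin using (Fin)
open import Data.List using (List; []; _∷_; length; filter; concat; allFin)
open import Data.List.Relation.Unary.Unique.Propositional using (Unique)
open import Data.List.Relation.Unary.All using (All)
open import Data.List.Relation.Binary.Permutation.Propositional using (_↭_)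
open import Data.Bool.Properties using (T?)
open import Data.Product using (_×_; ∃)
open import Relation.Binary.PropositionalEquality using (_≡_)
open import Relation.Nullary using (¬_)

record Graph : Set where
  field
    n      : ℕ
    adj    : Fin n → Fin n → Bool
    sym    : ∀ x y → adj x y ≡ adj y x
    irrefl : ∀ x → ¬ T (adj x x)

module _ (G : Graph) where
  open Graph G

  Adj : Fin n → Fin n → Set
  Adj x y = T (adj x y)

  deg : Fin n → ℕ
  deg x = length (filter (λ y → T? (adj x y)) (allFin n))

  data Walk : Fin n → Fin n → ℕ → Set where
    here : ∀ {a} → Walk a a zero
    step : ∀ {a b c k} → Adj a b → Walk b c k → Walk a c (suc k)

  data Chain : List (Fin n) → Set where
    nil  : Chain []
    one  : ∀ {x} → Chain (x ∷ [])
    cons : ∀ {x y xs} → Adj x y → Chain (y ∷ xs) → Chain (x ∷ y ∷ xs)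

  data EndsAt : List (Fin n) → Fin n → Set where
    endOne  : ∀ {x} → EndsAt (x ∷ []) x
    endCons : ∀ {x y xs b} → EndsAt (y ∷ xs) b → EndsAt (x ∷ y ∷ xs) b

  IsPathFromTo : List (Fin n) → Fin n → Fin n → Set
  IsPathFromTo P a b = ∃ (λ rest → P ≡ a ∷ rest) × EndsAt P b × Unique P × Chain P

  IsIsometricPath : List (Fin n) → Set
  IsIsometricPath P = ∃ λ a → ∃ λ b → IsPathFromTo P a b ×
                        (∀ k → Walk a b k → length P ∸ 1 ≤ k)

  IsIPPartition : List (List (Fin n)) → Set
  IsIPPartition Ps = All IsIsometricPath Ps × (concat Ps ↭ allFin n)

{-# OPTIONS --safe #-}
module Submission where

-- Take an IP-partition of minimum cardinality and delete u₁, v, u₂ from its paths, cutting each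
-- path into the maximal segments avoiding them; segments of isometric paths are isometric.
-- As u₁ and u₂ are leaves hanging at v, every edge of a path that meets T₃ = {u₁, v, u₂}
-- contains v, so a path P loses |P ∩ T₃| vertices and falls into at most 1 + 2·[v ∈ P] − |P ∩ T₃|
-- segments. Summed over the partition this leaves at most (number of paths) + 2 − 3 segments,
-- which makes room for the isometric path (u₁, v, u₂) itself.

open import Defs
open import Data.Nat using (_≤_)
open import Data.Fin using (Fin)
open import Data.List using (List; []; _∷_; length)
open import Data.List.Membership.Propositional using (_∈_)
open import Data.Product using (_×_; ∃)
open import Data.Sum using (_⊎_)
open import Function.Bundles using (_⇔_)
open import Relation.Binary.PropositionalEquality using (_≡_; _≢_)

open import Level using (Level)
open import Algebra.Properties.CommutativeSemigroup using (interchange)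
open import Data.Bool using (T; true; false; if_then_else_; _∨_)
open import Data.Bool.Properties using (T?)
open import Data.Empty using (⊥-elim)
open import Data.Fin.Properties using (any?; all?)
open import Data.List using (_++_; [_]; concat; concatMap; filter; map; allFin; cartesianProductWith)
open import Data.List.Properties
  using (length-++; length-++-≤ˡ; length-++-≤ʳ; length-tabulate; filter-++; concat-++;
         concat-map-[_])
open import Data.List.Extrema.Nat using (argmin; argmin-all; f[argmin]≤f[xs])
open import Data.List.Membership.Propositional.Properties
  using (∈-filter⁺; ∈-filter⁻; ∈-allFin; ∈-++⁺ˡ; ∈-++⁺ʳ; ∈-length; ∈-cartesianProductWith⁺)
open import Data.List.Membership.Propositional.Properties.WithK using (unique∧set⇒bag)
open import Data.List.Relation.Binary.BagAndSetEquality using (∼bag⇒↭)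
open import Data.List.Relation.Binary.Permutation.Propositional using (_↭_; ↭-sym; ↭-reflexive; ↭⇒↭ₛ)
open import Data.List.Relation.Binary.Permutation.Propositional.Properties using (↭-length; ∈-resp-↭)
open import Data.List.Relation.Unary.All as All using (All; []; _∷_)
open import Data.List.Relation.Unary.All.Properties using (all-filter; ++⁻ˡ; concat⁺; map⁺)
open import Data.List.Relation.Unary.AllPairs using ([]; _∷_)
open import Data.List.Relation.Unary.Any using (here; there)
open import Data.List.Relation.Unary.Linked as Linked using (Linked; []; [-]; _∷_)
open import Data.List.Relation.Unary.Unique.Propositional using (Unique)
import Data.List.Relation.Unary.Unique.Propositional.Properties as Unique
open import Data.Nat using (ℕ; zero; suc; _+_; _*_; _<_; z≤n; s≤s)
open import Data.Nat.Properties
  using (≤-refl; ≤-trans; ≤-reflexive; ≤-pred; n≤1+n; m≤n⇒m≤1+n; m≤m+n; ≮⇒≥; <⇒≱; +-suc; +-comm;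
         +-identityʳ; *-suc; *-distribˡ-+; +-monoʳ-≤; +-mono-≤; +-cancelʳ-≤; +-commutativeSemigroup;
         allUpTo?; module ≤-Reasoning)
open import Data.Product using (_,_; proj₁; proj₂; uncurry; map₁; map₂)
open import Data.Sum using (inj₁; inj₂)
import Data.Sum as Sum
open import Function.Base using (id; _∘_)
open import Function.Bundles using (mk⇔; Equivalence)
open import Relation.Binary.Definitions using (DecidableEquality)
open import Relation.Binary.PropositionalEquality
  using (refl; sym; trans; cong; cong₂; subst; setoid; module ≡-Reasoning)
open import Relation.Nullary using (¬_; Dec; yes; no; ¬?; does)
open import Relation.Nullary.Decidable using (_×-dec_; map′)
import Relation.Nullary.Decidable as Dec
open import Relation.Unary using (Pred; Decidable)
open import Relation.Unary.Properties using (∁?)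

private
  variable
    a p q r : Level
    A : Set a

count : {P : Pred A p} → Decidable P → List A → ℕ
count P? xs = length (filter P? xs)

count-++ : {P : Pred A p} (P? : Decidable P) (xs ys : List A) → count P? (xs ++ ys) ≡ count P? xs + count P? ys
count-++ P? xs ys = trans (cong length (filter-++ P? xs ys)) (length-++ (filter P? xs))

distinct-∈⇒2≤length : ∀ {x y : A} {xs} → x ≢ y → x ∈ xs → y ∈ xs → 2 ≤ length xs
distinct-∈⇒2≤length x≢y (here refl) (here refl) = ⊥-elim (x≢y refl)
distinct-∈⇒2≤length x≢y (here _)    (there y∈)  = s≤s (∈-length y∈)
distinct-∈⇒2≤length x≢y (there x∈)  (here _)    = s≤s (∈-length x∈)
distinct-∈⇒2≤length x≢y (there x∈)  (there y∈)  = m≤n⇒m≤1+n (distinct-∈⇒2≤length x≢y x∈ y∈)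

∈⇒length≤length-concat : ∀ {xs : List A} {xss} → xs ∈ xss → length xs ≤ length (concat xss)
∈⇒length≤length-concat {xss = xs ∷ _}   (here refl) = length-++-≤ˡ xs
∈⇒length≤length-concat {xss = xs ∷ xss} (there xs∈) =
  ≤-trans (∈⇒length≤length-concat xs∈) (length-++-≤ʳ (concat xss) {xs})

length≤length-concat : ∀ {xss : List (List A)} → All (λ xs → 0 < length xs) xss →
                       length xss ≤ length (concat xss)
length≤length-concat []                             = z≤n
length≤length-concat {xss = xs ∷ _} (0<|xs| ∷ 0<|xss|) =
  ≤-trans (+-mono-≤ 0<|xs| (length≤length-concat 0<|xss|)) (≤-reflexive (sym (length-++ xs)))

unique-++⁻ˡ : ∀ (xs : List A) {ys} → Unique (xs ++ ys) → Unique xs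
unique-++⁻ˡ []       _           = []
unique-++⁻ˡ (x ∷ xs) (x∉ ∷ xs!) = ++⁻ˡ xs x∉ ∷ unique-++⁻ˡ xs xs!

unique∧set⇒↭ : ∀ {xs ys : List A} → Unique xs → Unique ys → (∀ {x} → x ∈ xs ⇔ x ∈ ys) → xs ↭ ys
unique∧set⇒↭ xs! ys! xs≈ys = ∼bag⇒↭ (unique∧set⇒bag xs! ys! xs≈ys)

module _ (_≟_ : DecidableEquality A) where
  open import Data.List.Membership.DecPropositional _≟_ using (_∈?_)

  count-∈?≡length : ∀ {xs ys} → Unique xs → Unique ys → (∀ {y} → y ∈ ys → y ∈ xs) →
                    count (_∈? ys) xs ≡ length ys
  count-∈?≡length {xs} {ys} xs! ys! ys⊆xs = ↭-length (unique∧set⇒↭ (Unique.filter⁺ (_∈? ys) xs!) ys!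
    (mk⇔ (λ y∈ → proj₂ (∈-filter⁻ (_∈? ys) {xs = xs} y∈))
         (λ y∈ → ∈-filter⁺ (_∈? ys) (ys⊆xs y∈) y∈)))

listing⇔↭-allFin : ∀ {n} {xs : List (Fin n)} → (Unique xs × (∀ x → x ∈ xs)) ⇔ (xs ↭ allFin n)
listing⇔↭-allFin {n} = mk⇔
  (λ (xs! , complete) →
     unique∧set⇒↭ xs! (Unique.allFin⁺ n) (mk⇔ (λ _ → ∈-allFin _) (λ _ → complete _)))
  (λ xs↭ →
     Unique-resp-↭ (↭⇒↭ₛ (↭-sym xs↭)) (Unique.allFin⁺ n) , λ x → ∈-resp-↭ (↭-sym xs↭) (∈-allFin x))
  where
  open import Data.List.Relation.Binary.Permutation.Setoid.Properties (setoid (Fin n))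
    using (Unique-resp-↭)

listsUpTo : ℕ → List A → List (List A)
listsUpTo zero    xs = [ [] ]
listsUpTo (suc k) xs = [] ∷ cartesianProductWith _∷_ xs (listsUpTo k xs)

∈-listsUpTo : ∀ k {xs ys : List A} → All (_∈ xs) ys → length ys ≤ k → ys ∈ listsUpTo k xs
∈-listsUpTo zero    []           _          = here refl
∈-listsUpTo (suc k) []           _          = here refl
∈-listsUpTo (suc k) (y∈ ∷ ys⊆xs) (s≤s ys≤k) =
  there (∈-cartesianProductWith⁺ _∷_ y∈ (∈-listsUpTo k ys⊆xs ys≤k))

minimal-witness : ∀ {B : Set a} {P : Pred B p} (P? : Decidable P) (f : B → ℕ) {b} (candidates : List B) →
                  (∀ {c} → P c → c ∈ candidates) → P b → ∃ λ m → P m × (∀ c → P c → f m ≤ f c)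
minimal-witness P? f {b} cs complete pb =
  argmin f b (filter P? cs) ,
  argmin-all f pb (all-filter P? cs) ,
  λ c pc → All.lookup (f[argmin]≤f[xs] {f = f} b (filter P? cs)) (∈-filter⁺ P? (complete pc) pc)

-- The same words as wordsBy of Data.List.Base, whose hidden accumulator proofs cannot reach.
module Words {P : Pred A p} (P? : Decidable P) where

  addWord : List A → List (List A) → List (List A)
  addWord []      ws = ws
  addWord (x ∷ w) ws = (x ∷ w) ∷ ws

  splitWord : List A → List A × List (List A)
  splitWord []       = [] , []
  splitWord (x ∷ xs) with P? x
  ... | yes _ = [] , uncurry addWord (splitWord xs)
  ... | no  _ = map₁ (x ∷_) (splitWord xs)

  words : List A → List (List A)
  words xs = uncurry addWord (splitWord xs)

  allWords : List (List A) → List (List A)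
  allWords = concatMap words

  concat-addWord : ∀ w ws → concat (addWord w ws) ≡ w ++ concat ws
  concat-addWord []      ws = refl
  concat-addWord (x ∷ w) ws = refl

  concat-splitWord : ∀ xs → proj₁ (splitWord xs) ++ concat (proj₂ (splitWord xs)) ≡ filter (∁? P?) xs
  concat-splitWord []       = refl
  concat-splitWord (x ∷ xs) with P? x
  ... | yes _ = trans (concat-addWord (proj₁ (splitWord xs)) _) (concat-splitWord xs)
  ... | no  _ = cong (x ∷_) (concat-splitWord xs)

  concat-words : ∀ xs → concat (words xs) ≡ filter (∁? P?) xs
  concat-words xs = trans (concat-addWord (proj₁ (splitWord xs)) _) (concat-splitWord xs)

  concat-allWords : ∀ xss → concat (allWords xss) ≡ filter (∁? P?) (concat xss)
  concat-allWords []         = refl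
  concat-allWords (xs ∷ xss) = begin
    concat (words xs ++ allWords xss)                 ≡⟨ sym (concat-++ (words xs) (allWords xss)) ⟩
    concat (words xs) ++ concat (allWords xss)        ≡⟨ cong₂ _++_ (concat-words xs) (concat-allWords xss) ⟩
    filter (∁? P?) xs ++ filter (∁? P?) (concat xss)  ≡⟨ sym (filter-++ (∁? P?) xs (concat xss)) ⟩
    filter (∁? P?) (xs ++ concat xss)                 ∎
    where open ≡-Reasoning

  splitWord-prefix : ∀ xs → ∃ λ ys → proj₁ (splitWord xs) ++ ys ≡ xs
  splitWord-prefix []       = [] , refl
  splitWord-prefix (x ∷ xs) with P? x
  ... | yes _ = x ∷ xs , refl
  ... | no  _ = map₂ (cong (x ∷_)) (splitWord-prefix xs)

  module _ {R : Pred (List A) r}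
           (tail-closed : ∀ {x y ys} → R (x ∷ y ∷ ys) → R (y ∷ ys))
           (prefix-closed : ∀ {x} xs {ys} → R (x ∷ xs ++ ys) → R (x ∷ xs)) where

    mutual
      All-words : ∀ {xs} → R xs → All R (words xs)
      All-words {xs} rxs with splitWord xs | splitWord-prefix xs | All-laterWords rxs
      ... | []    , _ | _        | rws = rws
      ... | x ∷ w , _ | _ , refl | rws = prefix-closed w rxs ∷ rws

      -- Recursive calls on y ∷ ys sit in the with-heads: inside with-branches the termination
      -- checker does not recognise them as structurally smaller.
      All-laterWords : ∀ {xs} → R xs → All R (proj₂ (splitWord xs))
      All-laterWords {[]}         _   = []
      All-laterWords {x ∷ []}     _   with P? x
      ... | yes _ = []
      ... | no  _ = []
      All-laterWords {x ∷ y ∷ ys} rxs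
        with P? x | All-words (tail-closed rxs) | All-laterWords (tail-closed rxs)
      ... | yes _ | rws | _   = rws
      ... | no  _ | _   | rws = rws

    All-allWords : ∀ {xss} → All R xss → All R (allWords xss)
    All-allWords rs = concat⁺ (map⁺ (All.map All-words rs))

  boundaries : List A → ℕ
  boundaries []           = 0
  boundaries (x ∷ [])     = 0
  boundaries (x ∷ y ∷ xs) = (if does (P? x) ∨ does (P? y) then 1 else 0) + boundaries (y ∷ xs)

  boundaries-∷ : ∀ x xs → boundaries (x ∷ xs) ≤ suc (boundaries xs)
  boundaries-∷ x []       = z≤n
  boundaries-∷ x (y ∷ xs) with does (P? x) ∨ does (P? y)
  ... | true  = ≤-refl
  ... | false = n≤1+n _

  length-words-≤ : ∀ xs → length (words xs) + count P? xs ≤ suc (boundaries xs)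
  length-words-≤ []           = z≤n
  length-words-≤ (x ∷ [])     with P? x
  ... | yes _ = ≤-refl
  ... | no  _ = ≤-refl
  length-words-≤ (x ∷ y ∷ xs) with P? x | length-words-≤ (y ∷ xs)
  ... | yes _ | ih = ≤-trans (≤-reflexive (+-suc _ _)) (s≤s ih)
  ... | no  _ | ih with P? y
  ...   | yes _ = s≤s ih
  ...   | no  _ = ih

  module _ {Q : Pred A q} (Q? : Decidable Q) where
    open ≤-Reasoning

    Guarded : List A → Set _
    Guarded = Linked (λ x y → P x ⊎ P y → Q x ⊎ Q y)

    boundaries-+-head-≤ : ∀ {x xs} → Guarded (x ∷ xs) →
                          boundaries (x ∷ xs) + count Q? [ x ] ≤ 2 * count Q? (x ∷ xs)
    boundaries-+-head-≤ [-] = m≤m+n _ _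
    boundaries-+-head-≤ {x} {y ∷ xs} (link ∷ g) with Q? x | boundaries-+-head-≤ g
    ... | yes _ | ih = begin
      boundaries (x ∷ y ∷ xs) + 1    ≡⟨ +-comm _ 1 ⟩
      suc (boundaries (x ∷ y ∷ xs))  ≤⟨ s≤s (boundaries-∷ x (y ∷ xs)) ⟩
      2 + boundaries (y ∷ xs)        ≤⟨ +-monoʳ-≤ 2 (≤-trans (m≤m+n _ _) ih) ⟩
      2 + 2 * count Q? (y ∷ xs)      ≡⟨ sym (*-suc 2 _) ⟩
      2 * suc (count Q? (y ∷ xs))    ∎
    ... | no ¬qx | ih with Q? y
    ...   | yes _ = begin
      boundaries (x ∷ y ∷ xs) + 0    ≡⟨ +-identityʳ _ ⟩
      boundaries (x ∷ y ∷ xs)        ≤⟨ boundaries-∷ x (y ∷ xs) ⟩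
      suc (boundaries (y ∷ xs))      ≡⟨ +-comm 1 _ ⟩
      boundaries (y ∷ xs) + 1        ≤⟨ ih ⟩
      2 * suc (count Q? xs)          ∎
    ...   | no ¬qy with P? x | P? y
    ...     | no  _  | no  _  = ih
    ...     | yes px | _      = ⊥-elim (Sum.[ ¬qx , ¬qy ] (link (inj₁ px)))
    ...     | no  _  | yes py = ⊥-elim (Sum.[ ¬qx , ¬qy ] (link (inj₂ py)))

    boundaries-≤ : ∀ {xs} → Guarded xs → boundaries xs ≤ 2 * count Q? xs
    boundaries-≤ []                = z≤n
    boundaries-≤ {xs = _ ∷ _} g = ≤-trans (m≤m+n _ _) (boundaries-+-head-≤ g)

    guarded⇒length-words-≤ : ∀ {xs} → Guarded xs → length (words xs) + count P? xs ≤ 1 + 2 * count Q? xs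
    guarded⇒length-words-≤ {xs} g = ≤-trans (length-words-≤ xs) (s≤s (boundaries-≤ g))

    length-allWords-≤ : ∀ {xss} → All Guarded xss →
                        length (allWords xss) + count P? (concat xss) ≤ length xss + 2 * count Q? (concat xss)
    length-allWords-≤ []                 = z≤n
    length-allWords-≤ {xs ∷ xss} (g ∷ gs) = begin
      length (words xs ++ allWords xss) + count P? (xs ++ concat xss)
        ≡⟨ cong₂ _+_ (length-++ (words xs)) (count-++ P? xs (concat xss)) ⟩
      (length (words xs) + length (allWords xss)) + (count P? xs + count P? (concat xss))
        ≡⟨ interchange +-commutativeSemigroup (length (words xs)) _ _ _ ⟩
      (length (words xs) + count P? xs) + (length (allWords xss) + count P? (concat xss))
        ≤⟨ +-mono-≤ (guarded⇒length-words-≤ g) (length-allWords-≤ gs) ⟩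
      (1 + 2 * count Q? xs) + (length xss + 2 * count Q? (concat xss))
        ≡⟨ interchange +-commutativeSemigroup 1 (2 * count Q? xs) (length xss) _ ⟩
      suc (length xss) + (2 * count Q? xs + 2 * count Q? (concat xss))
        ≡⟨ cong (suc (length xss) +_) (sym (*-distribˡ-+ 2 (count Q? xs) _)) ⟩
      suc (length xss) + 2 * (count Q? xs + count Q? (concat xss))
        ≡⟨ cong (λ c → suc (length xss) + 2 * c) (sym (count-++ Q? xs (concat xss))) ⟩
      suc (length xss) + 2 * count Q? (xs ++ concat xss)
        ∎

module _ (G : Graph) where
  open Graph G using (n; adj)
  open import Data.Fin.Properties using (_≟_)
  open import Data.List.Membership.DecPropositional (_≟_ {n}) using (_∈?_)
  open import Data.List.Relation.Unary.Unique.DecPropositional (_≟_ {n}) using (unique?)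

  private
    variable
      x y z b c : Fin n
      k m : ℕ
      xs ys : List (Fin n)

  Adj-sym : Adj G x y → Adj G y x
  Adj-sym {x} {y} = subst T (Graph.sym G x y)

  Adj⇒≢ : Adj G x y → x ≢ y
  Adj⇒≢ {x} xy refl = Graph.irrefl G x xy

  deg≡1⇒neighbour-unique : deg G x ≡ 1 → Adj G x y → Adj G x z → y ≡ z
  deg≡1⇒neighbour-unique {x} {y} {z} deg≡1 xy xz with y ≟ z
  ... | yes y≡z = y≡z
  ... | no  y≢z =
    ⊥-elim (<⇒≱ (distinct-∈⇒2≤length y≢z (neighbour xy) (neighbour xz)) (≤-reflexive deg≡1))
    where
    neighbour : Adj G x c → c ∈ filter (T? ∘ adj x) (allFin n)
    neighbour = ∈-filter⁺ (T? ∘ adj x) (∈-allFin _)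

  walk-++ : Walk G x y k → Walk G y z m → Walk G x z (k + m)
  walk-++ here          w = w
  walk-++ (step xy w₁) w = step xy (walk-++ w₁ w)

  walk? : ∀ k x y → Dec (Walk G x y k)
  walk? zero    x y = map′ (λ { refl → here }) (λ { here → refl }) (x ≟ y)
  walk? (suc k) x y = map′ (λ (c , xc , w) → step xc w) (λ { (step xc w) → _ , xc , w })
                           (any? λ c → T? (adj x c) ×-dec walk? k c y)

  nonadjacent⇒2≤walk : x ≢ z → ¬ Adj G x z → Walk G x z k → 2 ≤ k
  nonadjacent⇒2≤walk x≢z _   here                = ⊥-elim (x≢z refl)
  nonadjacent⇒2≤walk _   ¬xz (step xz here)      = ⊥-elim (¬xz xz)
  nonadjacent⇒2≤walk _   _   (step _ (step _ _)) = s≤s (s≤s z≤n)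

  chain? : Decidable (Chain G)
  chain? []           = yes nil
  chain? (x ∷ [])     = yes one
  chain? (x ∷ y ∷ xs) =
    map′ (uncurry cons) (λ { (cons xy c) → xy , c }) (T? (adj x y) ×-dec chain? (y ∷ xs))

  chain⇒linked : Chain G xs → Linked (Adj G) xs
  chain⇒linked nil         = []
  chain⇒linked one         = [-]
  chain⇒linked (cons xy c) = xy ∷ chain⇒linked c

  final : Fin n → List (Fin n) → Fin n
  final x []       = x
  final x (y ∷ ys) = final y ys

  endsAt-final : ∀ x xs → EndsAt G (x ∷ xs) (final x xs)
  endsAt-final x []       = endOne
  endsAt-final x (y ∷ ys) = endCons (endsAt-final y ys)

  endsAt-unique : EndsAt G xs b → EndsAt G xs c → b ≡ c
  endsAt-unique endOne      endOne       = refl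
  endsAt-unique (endCons e) (endCons e′) = endsAt-unique e e′

  endsAt-++⁻ : ∀ xs → EndsAt G (x ∷ xs ++ ys) b → EndsAt G (final x xs ∷ ys) b
  endsAt-++⁻ []       e           = e
  endsAt-++⁻ (y ∷ xs) (endCons e) = endsAt-++⁻ xs e

  chain-++⁻ : ∀ xs → Chain G (x ∷ xs ++ ys) → Chain G (x ∷ xs) × Chain G (final x xs ∷ ys)
  chain-++⁻ []       c           = one , c
  chain-++⁻ (y ∷ xs) (cons xy c) = map₁ (cons xy) (chain-++⁻ xs c)

  walk-along : Chain G (x ∷ xs) → EndsAt G (x ∷ xs) b → Walk G x b (length xs)
  walk-along one         endOne      = here
  walk-along (cons xy c) (endCons e) = step xy (walk-along c e)

  isometric : EndsAt G (x ∷ xs) b → Unique (x ∷ xs) → Chain G (x ∷ xs) →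
              (∀ k → Walk G x b k → length xs ≤ k) → IsIsometricPath G (x ∷ xs)
  isometric e xs! c shortest = _ , _ , ((_ , refl) , e , xs! , c) , shortest

  isometric-[_] : ∀ x → IsIsometricPath G [ x ]
  isometric-[ x ] = isometric endOne ([] ∷ []) one (λ _ _ → z≤n)

  isometric-P₃ : Adj G x y → Adj G y z → x ≢ z → ¬ Adj G x z → IsIsometricPath G (x ∷ y ∷ z ∷ [])
  isometric-P₃ xy yz x≢z ¬xz =
    isometric (endCons (endCons endOne)) ((Adj⇒≢ xy ∷ x≢z ∷ []) ∷ (Adj⇒≢ yz ∷ []) ∷ [] ∷ [])
              (cons xy (cons yz one)) (λ _ → nonadjacent⇒2≤walk x≢z ¬xz)

  isometric-tail : IsIsometricPath G (x ∷ y ∷ ys) → IsIsometricPath G (y ∷ ys)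
  isometric-tail (_ , _ , ((_ , refl) , endCons e , _ ∷ ys! , cons xy c) , shortest) =
    isometric e ys! c (λ k w → ≤-pred (shortest (suc k) (step xy w)))

  isometric-++⁻ˡ : ∀ {x} xs {ys} → IsIsometricPath G (x ∷ xs ++ ys) → IsIsometricPath G (x ∷ xs)
  isometric-++⁻ˡ {x} xs {ys} (_ , _ , ((_ , refl) , e , xs! , c) , shortest) =
    isometric (endsAt-final x xs) (unique-++⁻ˡ (x ∷ xs) xs!) (proj₁ (chain-++⁻ xs c)) λ k w →
      +-cancelʳ-≤ (length ys) (length xs) k (begin
        length xs + length ys  ≡⟨ sym (length-++ xs) ⟩
        length (xs ++ ys)      ≤⟨ shortest _ (walk-++ w rest) ⟩
        k + length ys          ∎)
    where
    open ≤-Reasoning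
    rest = walk-along (proj₂ (chain-++⁻ xs c)) (endsAt-++⁻ xs e)

  isometric⇒chain : IsIsometricPath G xs → Chain G xs
  isometric⇒chain (_ , _ , (_ , _ , _ , c) , _) = c

  isometric⇒nonempty : IsIsometricPath G xs → 0 < length xs
  isometric⇒nonempty (_ , _ , ((_ , refl) , _) , _) = s≤s z≤n

  isometric? : Decidable (IsIsometricPath G)
  isometric? []       = no λ { (_ , _ , ((_ , ()) , _) , _) }
  isometric? (x ∷ xs) = map′ fromParts toParts
    (unique? (x ∷ xs) ×-dec chain? (x ∷ xs) ×-dec allUpTo? (λ k → ¬? (walk? k x (final x xs))) (length xs))
    where
    NoShortcut = ∀ {k} → k < length xs → ¬ Walk G x (final x xs) k

    fromParts : Unique (x ∷ xs) × Chain G (x ∷ xs) × NoShortcut → IsIsometricPath G (x ∷ xs)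
    fromParts (xs! , c , noShortcut) =
      isometric (endsAt-final x xs) xs! c (λ k w → ≮⇒≥ λ k< → noShortcut k< w)

    toParts : IsIsometricPath G (x ∷ xs) → Unique (x ∷ xs) × Chain G (x ∷ xs) × NoShortcut
    toParts (_ , _ , ((_ , refl) , e , xs! , c) , shortest) = xs! , c , λ {k} k< w →
      <⇒≱ k< (shortest k (subst (λ b → Walk G x b k) (endsAt-unique (endsAt-final x xs) e) w))

  ipPartition? : Decidable (IsIPPartition G)
  ipPartition? Ps = All.all? isometric? Ps ×-dec
    Dec.map listing⇔↭-allFin (unique? (concat Ps) ×-dec all? (_∈? concat Ps))

  singletons-ipPartition : IsIPPartition G (map [_] (allFin n))
  singletons-ipPartition =
    map⁺ (All.universal isometric-[_] (allFin n)) , ↭-reflexive (concat-map-[_] (allFin n))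

  ipPartition⇒∈listsUpTo : ∀ {Ps} → IsIPPartition G Ps → Ps ∈ listsUpTo n (listsUpTo n (allFin n))
  ipPartition⇒∈listsUpTo {Ps} (isos , cover) =
    ∈-listsUpTo n
      (All.tabulate λ P∈ →
         ∈-listsUpTo n (All.universal ∈-allFin _) (≤-trans (∈⇒length≤length-concat P∈) |concat|≤n))
      (≤-trans (length≤length-concat (All.map isometric⇒nonempty isos)) |concat|≤n)
    where
    |concat|≤n : length (concat Ps) ≤ n
    |concat|≤n = ≤-reflexive (trans (↭-length cover) (length-tabulate id))

  minimum-ipPartition : ∃ λ Ps → IsIPPartition G Ps × (∀ Qs → IsIPPartition G Qs → length Ps ≤ length Qs)
  minimum-ipPartition =
    minimal-witness ipPartition? length _ ipPartition⇒∈listsUpTo singletons-ipPartition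

module PendantPath (G : Graph) (v u₁ u₂ : Fin (Graph.n G)) (u₁≢u₂ : u₁ ≢ u₂)
                   (leaves : ∀ w → ((Adj G v w × deg G w ≡ 1) ⇔ (w ≡ u₁ ⊎ w ≡ u₂))) where
  open Graph G using (n)
  open import Data.Fin.Properties using (_≟_)
  open import Data.List.Membership.DecPropositional (_≟_ {n}) using (_∈?_)

  private
    variable
      w x y : Fin n

  T₃ : List (Fin n)
  T₃ = u₁ ∷ v ∷ u₂ ∷ []

  open Words (_∈? T₃) public using (allWords)
  open Words (_∈? T₃) using (concat-allWords; All-allWords; Guarded; length-allWords-≤)

  v-adj-leaf : w ≡ u₁ ⊎ w ≡ u₂ → Adj G v w
  v-adj-leaf w≡uᵢ = proj₁ (Equivalence.from (leaves _) w≡uᵢ)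

  v≢leaf : w ≡ u₁ ⊎ w ≡ u₂ → v ≢ w
  v≢leaf w≡uᵢ = Adj⇒≢ G (v-adj-leaf w≡uᵢ)

  leaf-neighbour≡v : w ≡ u₁ ⊎ w ≡ u₂ → Adj G w x → x ≡ v
  leaf-neighbour≡v w≡uᵢ wx =
    deg≡1⇒neighbour-unique G (proj₂ (Equivalence.from (leaves _) w≡uᵢ)) wx (Adj-sym G (v-adj-leaf w≡uᵢ))

  edge-at-T₃ : Adj G x y → x ∈ T₃ → x ≡ v ⊎ y ≡ v
  edge-at-T₃ xy (here x≡u₁)                 = inj₂ (leaf-neighbour≡v (inj₁ x≡u₁) xy)
  edge-at-T₃ xy (there (here x≡v))          = inj₁ x≡v
  edge-at-T₃ xy (there (there (here x≡u₂))) = inj₂ (leaf-neighbour≡v (inj₂ x≡u₂) xy)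

  edge-meeting-T₃-meets-v : Adj G x y → x ∈ T₃ ⊎ y ∈ T₃ → x ∈ [ v ] ⊎ y ∈ [ v ]
  edge-meeting-T₃-meets-v xy (inj₁ x∈) = Sum.map here here (edge-at-T₃ xy x∈)
  edge-meeting-T₃-meets-v xy (inj₂ y∈) = Sum.swap (Sum.map here here (edge-at-T₃ (Adj-sym G xy) y∈))

  T₃-unique : Unique T₃
  T₃-unique = ((v≢leaf (inj₁ refl) ∘ sym) ∷ u₁≢u₂ ∷ []) ∷ (v≢leaf (inj₂ refl) ∷ []) ∷ [] ∷ []

  T₃-isometric : IsIsometricPath G T₃
  T₃-isometric = isometric-P₃ G (Adj-sym G (v-adj-leaf (inj₁ refl))) (v-adj-leaf (inj₂ refl)) u₁≢u₂
    λ u₁u₂ → v≢leaf (inj₂ refl) (sym (leaf-neighbour≡v (inj₁ refl) u₁u₂))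

  module _ {Ps} (ip : IsIPPartition G Ps) where
    private
      listing : Unique (concat Ps) × (∀ x → x ∈ concat Ps)
      listing = Equivalence.from listing⇔↭-allFin (proj₂ ip)

    T₃∷allWords-ipPartition : IsIPPartition G (T₃ ∷ allWords Ps)
    T₃∷allWords-ipPartition =
      T₃-isometric ∷ All-allWords (isometric-tail G) (isometric-++⁻ˡ G) (proj₁ ip) ,
      Equivalence.to listing⇔↭-allFin
        (subst (λ zs → Unique (T₃ ++ zs) × (∀ x → x ∈ T₃ ++ zs)) (sym (concat-allWords Ps))
               (unique , complete))
      where
      rest = filter (∁? (_∈? T₃)) (concat Ps)

      unique : Unique (T₃ ++ rest)
      unique = Unique.++⁺ T₃-unique (Unique.filter⁺ _ (proj₁ listing))
        λ (x∈T₃ , x∈rest) → proj₂ (∈-filter⁻ (∁? (_∈? T₃)) {xs = concat Ps} x∈rest) x∈T₃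

      complete : ∀ x → x ∈ T₃ ++ rest
      complete x with x ∈? T₃
      ... | yes x∈T₃ = ∈-++⁺ˡ x∈T₃
      ... | no  x∉T₃ = ∈-++⁺ʳ T₃ (∈-filter⁺ _ (proj₂ listing x) x∉T₃)

    length-T₃∷allWords-≤ : length (T₃ ∷ allWords Ps) ≤ length Ps
    length-T₃∷allWords-≤ = +-cancelʳ-≤ 2 _ _ (begin
      suc (length (allWords Ps)) + 2                      ≡⟨ sym (+-suc _ 2) ⟩
      length (allWords Ps) + 3                            ≡⟨ cong (length (allWords Ps) +_) (sym count-T₃) ⟩
      length (allWords Ps) + count (_∈? T₃) (concat Ps)   ≤⟨ length-allWords-≤ (_∈? [ v ]) guardedPaths ⟩
      length Ps + 2 * count (_∈? [ v ]) (concat Ps)       ≡⟨ cong (λ c → length Ps + 2 * c) count-v ⟩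
      length Ps + 2                                       ∎)
      where
      open ≤-Reasoning

      guardedPaths : All (Guarded (_∈? [ v ])) Ps
      guardedPaths = All.map (Linked.map edge-meeting-T₃-meets-v ∘ chain⇒linked G ∘ isometric⇒chain G) (proj₁ ip)

      count-T₃ : count (_∈? T₃) (concat Ps) ≡ 3
      count-T₃ = count-∈?≡length _≟_ (proj₁ listing) T₃-unique (λ _ → proj₂ listing _)

      count-v : count (_∈? [ v ]) (concat Ps) ≡ 1
      count-v = count-∈?≡length _≟_ (proj₁ listing) ([] ∷ []) (λ _ → proj₂ listing _)

mainTheorem7 : (G : Graph) → (v u₁ u₂ : Fin (Graph.n G)) →
    u₁ ≢ u₂ →
    (∀ w → ((Adj G v w × deg G w ≡ 1) ⇔ (w ≡ u₁ ⊎ w ≡ u₂))) →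
    ∃ λ Ps → IsIPPartition G Ps × ((u₁ ∷ v ∷ u₂ ∷ []) ∈ Ps) ×
      (∀ Qs → IsIPPartition G Qs → length Ps ≤ length Qs)
mainTheorem7 G v u₁ u₂ u₁≢u₂ leaves =
  let Ps , ip , minimum = minimum-ipPartition G in
  T₃ ∷ allWords Ps , T₃∷allWords-ipPartition ip , here refl ,
  λ Qs ipQs → ≤-trans (length-T₃∷allWords-≤ ip) (minimum Qs ipQs)
  where open PendantPath G v u₁ u₂ u₁≢u₂ leaves
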